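{- In an application of Res$'$, the resolvent of a set of loosely guarded clauses (LGCs) is a simple clause.
   Context: $var(E)$: variables of $E$. Variable depth: $vdp(t)=-1$ if $t$ ground, $0$ if a variable, $1+\max_i vdp(u_i)$ for non-ground $f(u_1,\dots,u_n)$. Flat: $vdp\le0$; simple: $vdp\le1$ (atoms/literals/clauses: all terms). A non-ground compound literal contains a non-ground compound term. A compound term $t$ is weakly covering if $var(s)=var(t)$ for each non-ground compound subterm $s$; a clause $C$ (resp. literal $L$) is weakly covering if each of its terms is ground, a variable, or a weakly covering term $t$ with $var(t)=var(C)$ (resp. $var(L)$). LGC: a simple, weakly covering clause which, if non-ground, contains flat negative literals $\lnot G_1,\dots,\lnot G_m$ (guards) such that each pair of its variables co-occurs in some $G_j$. Ordering: $\succ$ is a lexicographic path ordering with precedence function symbols $>$ constants $>$ predicate symbols, extended admissibly to literals; $L$ is strictly $\succ$-maximal in $C$ if no $L'\in C$ satisfies $L'\succeq L$. Query pair: atoms $A_1,\dots,A_n$ (flat, not all ground) and weakly covering simple atoms $B_1,\dots,B_n$, each a non-ground compound literal or ground, $var(\overline A)\cap var(\overline B)=\emptyset$, the $B_i$ pairwise variable-disjoint, with a simultaneous mgu $\sigma_0$, $A_i\sigma_0=B_i\sigma_0$ for all $i$. Top variable: $x\in var(\overline A)$ with $vdp(x\sigma_0)\ge vdp(y\sigma_0)$ for all $y\in var(\overline A)$. Res$'$: main premise $C=\lnot A_1\lor\dots\lor\lnot A_n\lor D$, a non-ground flat LGC with $D$ positive; side premises LGCs $C_i=B_i\lor D_i$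 ($1\le i\le n$), pairwise variable-disjoint and disjoint from $C$, with no literal selected and $B_i$ strictly $\succ$-maximal w.r.t. $C_i$, such that $(A_1,\dots,A_n;B_1,\dots,B_n)$ is a query pair. Reorder so that $A_1,\dots,A_t$ are exactly the atoms containing at least one top variable; with $\sigma$ an mgu such that $A_i\sigma=B_i\sigma$ ($1\le i\le t$), the resolvent is $(D_1\lor\dots\lor D_t\lor\lnot A_{t+1}\lor\dots\lor\lnot A_n\lor D)\sigma$. -}

module Defs where

open import Data.Nat using (ℕ; zero; suc; _≥_; _<_)
open import Data.Integer as ℤ using (ℤ; _⊔_; _≤_; 0ℤ; 1ℤ; -1ℤ)
open import Data.List using (List; []; _∷_; _++_; concatMap; map; concat)
open import Data.List.Membership.Propositional using (_∈_)
open import Data.Vec as Vec using (Vec; []; _∷_)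
import Data.Vec.Membership.Propositional as VM
open import Data.Vec.Relation.Unary.All as VAll using (All)
open import Data.Vec.Relation.Unary.Any as VAny using (Any)
open import Data.Fin using (Fin)
open import Data.List using (allFin)
open import Data.Sum using (_⊎_; inj₁; inj₂)
open import Data.Product using (Σ; ∃; _×_; _,_)
open import Data.Empty using (⊥)
import Data.Unit
open import Data.Bool using (Bool; true; false; if_then_else_)
open import Relation.Nullary using (¬_; Dec; does)
open import Relation.Binary.PropositionalEquality using (_≡_; _≢_)

record Sig : Set₁ where
  field
    Fun    : Set
    arity  : Fun → ℕ
    Pred   : Set
    parity : Pred → ℕ

data Tm (S : Set) (ar : S → ℕ) : Set where
  var : ℕ → Tm S ar
  app : (f : S) → Vec (Tm S ar) (ar f) → Tm S ar

module _ {S : Set} {ar : S → ℕ} where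

  varsT  : Tm S ar → List ℕ
  varsTs : ∀ {n} → Vec (Tm S ar) n → List ℕ
  varsT (var x)    = x ∷ []
  varsT (app f ts) = varsTs ts
  varsTs []       = []
  varsTs (t ∷ ts) = varsT t ++ varsTs ts

  module LPO (_⋗_ : S → S → Set) where
    mutual
      data _>lpo_ : Tm S ar → Tm S ar → Set where
        lpo-var  : ∀ {f ss x} → x ∈ varsTs ss → app f ss >lpo var x
        lpo-sub  : ∀ {f ss t} → Any (λ si → si ≥lpo t) ss → app f ss >lpo t
        lpo-prec : ∀ {f g ss ts} → f ⋗ g → All (λ tj → app f ss >lpo tj) ts
                   → app f ss >lpo app g ts
        lpo-lex  : ∀ {f ss ts} → All (λ tj → app f ss >lpo tj) ts
                   → Lex ss ts → app f ss >lpo app f ts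

      data _≥lpo_ : Tm S ar → Tm S ar → Set where
        ≥-eq : ∀ {s} → s ≥lpo s
        ≥-gt : ∀ {s t} → s >lpo t → s ≥lpo t

      data Lex : ∀ {n} → Vec (Tm S ar) n → Vec (Tm S ar) n → Set where
        lex-here  : ∀ {n s t} {ss ts : Vec (Tm S ar) n} → s >lpo t → Lex (s ∷ ss) (t ∷ ts)
        lex-there : ∀ {n s} {ss ts : Vec (Tm S ar) n} → Lex ss ts → Lex (s ∷ ss) (s ∷ ts)

module Syntax (Σ' : Sig) where
  open Sig Σ' public

  Term : Set
  Term = Tm Fun arity

  record Atom : Set where
    constructor _⟨_⟩
    field
      pred : Pred
      args : Vec Term (parity pred)
  open Atom public

  data Literal : Set where
    pos : Atom → Literal
    neg : Atom → Literal

  Clause : Set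
  Clause = List Literal

  atomOf : Literal → Atom
  atomOf (pos A) = A
  atomOf (neg A) = A

  IsPos : Literal → Set
  IsPos L = ∃ λ A → L ≡ pos A

  IsNeg : Literal → Set
  IsNeg L = ∃ λ A → L ≡ neg A

  _∈args_ : Term → Literal → Set
  t ∈args L = t VM.∈ args (atomOf L)

  varsA : Atom → List ℕ
  varsA A = varsTs (args A)

  varsL : Literal → List ℕ
  varsL L = varsA (atomOf L)

  varsC : Clause → List ℕ
  varsC = concatMap varsL

  GroundT : Term → Set
  GroundT t = varsT t ≡ []

  GroundA : Atom → Set
  GroundA A = varsA A ≡ []

  GroundC : Clause → Set
  GroundC C = varsC C ≡ []

  IsVar : Term → Set
  IsVar t = ∃ λ x → t ≡ var x

  _≈v_ : List ℕ → List ℕ → Set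
  xs ≈v ys = ∀ x → (x ∈ xs → x ∈ ys) × (x ∈ ys → x ∈ xs)

  Disjoint : List ℕ → List ℕ → Set
  Disjoint xs ys = ∀ x → x ∈ xs → x ∈ ys → ⊥

  private
    groundCase : List ℕ → ℤ → ℤ
    groundCase []      _ = -1ℤ
    groundCase (_ ∷ _) m = 1ℤ ℤ.+ m

  vdp  : Term → ℤ
  vdps : ∀ {n} → Vec Term n → ℤ
  vdp (var x)      = 0ℤ
  vdp (app f ts)   = groundCase (varsTs ts) (vdps ts)
  vdps []       = -1ℤ
  vdps (t ∷ ts) = vdp t ⊔ vdps ts

  FlatT : Term → Set
  FlatT t = vdp t ≤ 0ℤ

  SimpleT : Term → Set
  SimpleT t = vdp t ≤ 1ℤ

  FlatL : Literal → Set
  FlatL L = ∀ t → t ∈args L → FlatT t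

  FlatA : Atom → Set
  FlatA A = FlatL (pos A)

  FlatC : Clause → Set
  FlatC C = ∀ L → L ∈ C → FlatL L

  SimpleL : Literal → Set
  SimpleL L = ∀ t → t ∈args L → SimpleT t

  SimpleA : Atom → Set
  SimpleA A = SimpleL (pos A)

  SimpleC : Clause → Set
  SimpleC C = ∀ L → L ∈ C → SimpleL L

  data Compound : Term → Set where
    compound : ∀ {f ts} → 1 Data.Nat.≤ arity f → Compound (app f ts)

  data _⊑_ : Term → Term → Set where
    ⊑-refl : ∀ {t} → t ⊑ t
    ⊑-arg  : ∀ {s u f ts} → s ⊑ u → u VM.∈ ts → s ⊑ app f ts

  NonGroundCompound : Term → Set
  NonGroundCompound t = Compound t × ¬ GroundT t

  NGCompoundL : Literal → Set
  NGCompoundL L = ∃ λ t → ∃ λ s → t ∈args L × s ⊑ t × NonGroundCompound s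

  WeaklyCoveringT : Term → Set
  WeaklyCoveringT t =
    Compound t × (∀ s → s ⊑ t → NonGroundCompound s → varsT s ≈v varsT t)

  WCTermIn : List ℕ → Term → Set
  WCTermIn V t = GroundT t ⊎ IsVar t ⊎ (WeaklyCoveringT t × varsT t ≈v V)

  WeaklyCoveringL : Literal → Set
  WeaklyCoveringL L = ∀ t → t ∈args L → WCTermIn (varsL L) t

  WeaklyCoveringA : Atom → Set
  WeaklyCoveringA A = WeaklyCoveringL (pos A)

  WeaklyCoveringC : Clause → Set
  WeaklyCoveringC C = ∀ L → L ∈ C → ∀ t → t ∈args L → WCTermIn (varsC C) t

  Guarded : Clause → Set
  Guarded C = ∀ x y → x ∈ varsC C → y ∈ varsC C →
    ∃ λ G → neg G ∈ C × FlatA G × x ∈ varsA G × y ∈ varsA G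

  LGC : Clause → Set
  LGC C = SimpleC C × WeaklyCoveringC C × (¬ GroundC C → Guarded C)

  Subst : Set
  Subst = ℕ → Term

  _·T_  : Term → Subst → Term
  _·Ts_ : ∀ {n} → Vec Term n → Subst → Vec Term n
  var x    ·T σ = σ x
  app f ts ·T σ = app f (ts ·Ts σ)
  []       ·Ts σ = []
  (t ∷ ts) ·Ts σ = (t ·T σ) ∷ (ts ·Ts σ)

  _·A_ : Atom → Subst → Atom
  (p ⟨ ts ⟩) ·A σ = p ⟨ ts ·Ts σ ⟩

  _·L_ : Literal → Subst → Literal
  pos A ·L σ = pos (A ·A σ)
  neg A ·L σ = neg (A ·A σ)

  _·C_ : Clause → Subst → Clause
  C ·C σ = map (_·L σ) C

  IsMGU : ∀ {n} → (Fin n → Set) → (Fin n → Atom) → (Fin n → Atom) → Subst → Set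
  IsMGU P A B σ =
    (∀ i → P i → A i ·A σ ≡ B i ·A σ) ×
    (∀ θ → (∀ i → P i → A i ·A θ ≡ B i ·A θ) →
       ∃ λ δ → ∀ x → θ x ≡ (σ x ·T δ))

  Sym : Set
  Sym = Fun ⊎ Pred

  symArity : Sym → ℕ
  symArity (inj₁ f) = arity f
  symArity (inj₂ p) = parity p

  BigTerm : Set
  BigTerm = Tm Sym symArity

  embT  : Term → BigTerm
  embTs : ∀ {n} → Vec Term n → Vec BigTerm n
  embT (var x)    = var x
  embT (app f ts) = app (inj₁ f) (embTs ts)
  embTs []       = []
  embTs (t ∷ ts) = embT t ∷ embTs ts

  embA : Atom → BigTerm
  embA (p ⟨ ts ⟩) = app (inj₂ p) (embTs ts)

  record Precedence : Set₁ where
    field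
      _⋗_        : Sym → Sym → Set
      irrefl     : ∀ {a} → ¬ (a ⋗ a)
      trans      : ∀ {a b c} → a ⋗ b → b ⋗ c → a ⋗ c
      fun>const  : ∀ f c → 1 Data.Nat.≤ arity f → arity c ≡ 0 → inj₁ f ⋗ inj₁ c
      const>pred : ∀ c p → arity c ≡ 0 → inj₁ c ⋗ inj₂ p

  module Order (prec : Precedence) where
    open Precedence prec
    open LPO {S = Sym} {ar = symArity} _⋗_ public

    _≻A_ : Atom → Atom → Set
    A ≻A B = embA A >lpo embA B

    _⪰A_ : Atom → Atom → Set
    A ⪰A B = embA A ≥lpo embA B

    -- admissible extension to literals (= multiset extension on
    -- {A} for A and {A,A} for ¬A): ¬A ≻ A
    _≻L_ : Literal → Literal → Set
    pos A ≻L pos B = A ≻A B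
    pos A ≻L neg B = A ≻A B
    neg A ≻L pos B = A ⪰A B
    neg A ≻L neg B = A ≻A B

    _⪰L_ : Literal → Literal → Set
    L ⪰L L' = L ≡ L' ⊎ L ≻L L'

  record Selection : Set where
    field
      sel    : Clause → List Literal
      sel-ok : ∀ C L → L ∈ sel C → L ∈ C × IsNeg L

  varsAs : ∀ {n} → (Fin n → Atom) → List ℕ
  varsAs {n} A = concatMap (λ i → varsA (A i)) (allFin n)

  TopVar : ∀ {n} → (Fin n → Atom) → Subst → ℕ → Set
  TopVar A σ₀ x = x ∈ varsAs A × (∀ y → y ∈ varsAs A → vdp (σ₀ y) ≤ vdp (σ₀ x))

  HasTop : ∀ {n} → (Fin n → Atom) → Subst → Fin n → Set
  HasTop A σ₀ i = ∃ λ x → x ∈ varsA (A i) × TopVar A σ₀ x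

  record QueryPair {n : ℕ} (A B : Fin n → Atom) (σ₀ : Subst) : Set where
    field
      A-flat      : ∀ i → FlatA (A i)
      A-nonground : ∃ λ i → ¬ GroundA (A i)
      B-wc        : ∀ i → WeaklyCoveringA (B i)
      B-simple    : ∀ i → SimpleA (B i)
      B-shape     : ∀ i → (¬ GroundA (B i) × NGCompoundL (pos (B i))) ⊎ GroundA (B i)
      AB-disjoint : ∀ i j → Disjoint (varsA (A i)) (varsA (B j))
      B-disjoint  : ∀ i j → i ≢ j → Disjoint (varsA (B i)) (varsA (B j))
      σ₀-mgu      : IsMGU (λ _ → Data.Unit.⊤) A B σ₀

  negs : ∀ {n} → (Fin n → Atom) → Clause
  negs {n} A = map (λ i → neg (A i)) (allFin n)

  sidePremise : ∀ {n} → (Fin n → Atom) → (Fin n → Clause) → Fin n → Clause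
  sidePremise B Ds i = pos (B i) ∷ Ds i

  record Res′Premises (prec : Precedence) (Sel : Selection) {n : ℕ}
         (A : Fin n → Atom) (D : Clause) (B : Fin n → Atom) (Ds : Fin n → Clause)
         (σ₀ : Subst) : Set where
    open Order prec
    open Selection Sel
    field
      main-LGC       : LGC (negs A ++ D)
      main-flat      : FlatC (negs A ++ D)
      main-nonground : ¬ GroundC (negs A ++ D)
      D-positive     : ∀ L → L ∈ D → IsPos L
      side-LGC       : ∀ i → LGC (sidePremise B Ds i)
      side-disjoint  : ∀ i j → i ≢ j →
                       Disjoint (varsC (sidePremise B Ds i)) (varsC (sidePremise B Ds j))
      side-main-disj : ∀ i → Disjoint (varsC (sidePremise B Ds i)) (varsC (negs A ++ D))
      side-nosel     : ∀ i → sel (sidePremise B Ds i) ≡ []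
      side-max       : ∀ i L → L ∈ Ds i → ¬ (L ⪰L pos (B i))
      query          : QueryPair A B σ₀

  resolvent : ∀ {n} (A : Fin n → Atom) (D : Clause) (Ds : Fin n → Clause)
              {P : Fin n → Set} (dec : ∀ i → Dec (P i)) (σ : Subst) → Clause
  resolvent {n} A D Ds dec σ =
    (concatMap (λ i → if does (dec i) then Ds i else (neg (A i) ∷ [])) (allFin n) ++ D) ·C σ

module Submission where

-- Call a variable of A₁ … Aₙ top if σ₀ maps it to maximal depth. Let θ agree with σ where σ
-- is ground, map every other non-top variable to a fixed variable, and for a top v replace the
-- non-ground arguments of σ v by that variable. θ still unifies each pair Aᵢ = Bᵢ containing a
-- top variable:
--  * a variable matched against a compound argument f(bs) of Bᵢ is top, since by weak
--    covering every argument of Bᵢ is σ₀-shallower than f(bs);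
--  * a top z matched against a variable y of Bᵢ has σ z ground: the compound argument of Bᵢ
--    covering y is matched against a variable w with σ₀ w deeper than σ₀ y = σ₀ z, so by
--    maximality σ₀ z is ground. Then σ₀ grounds A₁ … Aₙ, so the atoms without top variables
--    are ground and σ, changed to σ₀ on their side premises, unifies all pairs; being an
--    instance of σ₀, it grounds z.
-- As σ is most general, θ = σδ for some δ. Hence σ v is ground or a variable for non-top v and
-- has depth at most 1 for all v, and the resolvent, which instantiates flat literals of the
-- main premise and simple side literals free of top variables, is simple.

open import Defs
open import Data.Nat using (ℕ; z≤n)
open import Data.Fin as Fin using (Fin)

open import Data.Integer as ℤ using (ℤ; 0ℤ; 1ℤ; -1ℤ; -≤+; +≤+)
import Data.Integer.Properties as ℤP
open import Data.List using (List; []; _∷_; _++_; concatMap; allFin)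
open import Data.List.Membership.Propositional using (_∈_; _∉_; find; lose)
open import Data.List.Membership.Propositional.Properties
  using (∈-++⁺ˡ; ∈-++⁺ʳ; ∈-++⁻; ∈-map⁺; ∈-map⁻; ∈-allFin; ∈-concatMap⁺; ∈-concatMap⁻)
open import Data.List.Membership.DecPropositional Data.Nat._≟_ using (_∈?_)
open import Data.List.Relation.Unary.Any using (here; there)
import Data.List.Relation.Unary.All as All
open import Data.Vec as Vec using (Vec; []; _∷_)
import Data.Vec.Properties as VecP
import Data.Vec.Membership.Propositional as VM
open import Data.Vec.Relation.Unary.Any using (here; there)
open import Data.Sum using (_⊎_; inj₁; inj₂)
open import Data.Product using (Σ; ∃; _×_; _,_; proj₁; proj₂)
open import Data.Empty using (⊥; ⊥-elim)
open import Data.Unit using (tt)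
open import Data.Bool using (if_then_else_)
open import Function using (_∘_)
open import Relation.Nullary using (Dec; ¬_; yes; no; does)
open import Relation.Binary.PropositionalEquality
  using (_≡_; refl; sym; trans; cong; cong₂; subst; subst₂; module ≡-Reasoning)

module _ {X Y : Set} (f : X → List Y) where

  ∈-concatMap⁺′ : ∀ {xs x y} → x ∈ xs → y ∈ f x → y ∈ concatMap f xs
  ∈-concatMap⁺′ x∈xs y∈fx = ∈-concatMap⁺ f (lose x∈xs y∈fx)

  ∈-concatMap⁻′ : ∀ xs {y} → y ∈ concatMap f xs → ∃ λ x → x ∈ xs × y ∈ f x
  ∈-concatMap⁻′ xs = find ∘ ∈-concatMap⁻ f {xs}

module _ {X : Set} where

  ≡[]⇒∉ : ∀ {xs : List X} {x} → xs ≡ [] → x ∉ xs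
  ≡[]⇒∉ refl ()

  ∉⇒≡[] : ∀ (xs : List X) → (∀ x → x ∉ xs) → xs ≡ []
  ∉⇒≡[] []      _ = refl
  ∉⇒≡[] (x ∷ _) h = ⊥-elim (h x (here refl))

  ∷≢[] : ∀ {x : X} {xs : List X} → x ∷ xs ≡ [] → ⊥
  ∷≢[] ()

module Terms (Σ' : Sig) where
  open Syntax Σ'

  ∈-varsTs⁺ : ∀ {n v u} {ts : Vec Term n} → u VM.∈ ts → v ∈ varsT u → v ∈ varsTs ts
  ∈-varsTs⁺ {ts = t ∷ ts} (here refl) v∈u = ∈-++⁺ˡ v∈u
  ∈-varsTs⁺ {ts = t ∷ ts} (there u∈ts) v∈u = ∈-++⁺ʳ (varsT t) (∈-varsTs⁺ u∈ts v∈u)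

  ∈-varsTs⁻ : ∀ {n v} (ts : Vec Term n) → v ∈ varsTs ts → ∃ λ u → u VM.∈ ts × v ∈ varsT u
  ∈-varsTs⁻ (t ∷ ts) v∈ with ∈-++⁻ (varsT t) v∈
  ... | inj₁ v∈t = t , here refl , v∈t
  ... | inj₂ v∈ts = let u , u∈ts , v∈u = ∈-varsTs⁻ ts v∈ts in u , there u∈ts , v∈u

  ground-arg : ∀ {n u} {ts : Vec Term n} → varsTs ts ≡ [] → u VM.∈ ts → GroundT u
  ground-arg g u∈ts = ∉⇒≡[] _ (λ v v∈u → ≡[]⇒∉ g (∈-varsTs⁺ u∈ts v∈u))

  ⊑-ground : ∀ {s t} → s ⊑ t → GroundT t → GroundT s
  ⊑-ground ⊑-refl g = g
  ⊑-ground (⊑-arg s⊑u u∈ts) g = ⊑-ground s⊑u (ground-arg g u∈ts)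

  ⊑-var⇒¬compound : ∀ {s x} → s ⊑ var x → ¬ Compound s
  ⊑-var⇒¬compound ⊑-refl ()

  ·T-cong : ∀ {θ σ : Subst} t → (∀ v → v ∈ varsT t → θ v ≡ σ v) → t ·T θ ≡ t ·T σ
  ·Ts-cong : ∀ {θ σ : Subst} {n} (ts : Vec Term n) → (∀ v → v ∈ varsTs ts → θ v ≡ σ v) →
             ts ·Ts θ ≡ ts ·Ts σ
  ·T-cong (var x) h = h x (here refl)
  ·T-cong (app f ts) h = cong (app f) (·Ts-cong ts h)
  ·Ts-cong [] h = refl
  ·Ts-cong (t ∷ ts) h =
    cong₂ _∷_ (·T-cong t (λ v → h v ∘ ∈-++⁺ˡ)) (·Ts-cong ts (λ v → h v ∘ ∈-++⁺ʳ (varsT t)))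

  ·A-cong : ∀ {θ σ : Subst} B → (∀ v → v ∈ varsA B → θ v ≡ σ v) → B ·A θ ≡ B ·A σ
  ·A-cong (p ⟨ ts ⟩) h = cong (p ⟨_⟩) (·Ts-cong ts h)

  ·Ts-identity : ∀ {n} (ts : Vec Term n) → ts ·Ts var ≡ ts
  ·Ts-identity [] = refl
  ·Ts-identity (var x ∷ ts) = cong (var x ∷_) (·Ts-identity ts)
  ·Ts-identity (app f us ∷ ts) = cong₂ _∷_ (cong (app f) (·Ts-identity us)) (·Ts-identity ts)

  ·T-ground : ∀ {σ} t → GroundT t → t ·T σ ≡ t
  ·T-ground (var x) ()
  ·T-ground (app f ts) g =
    cong (app f) (trans (·Ts-cong ts (λ v v∈ → ⊥-elim (≡[]⇒∉ g v∈))) (·Ts-identity ts))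

  ·A-ground : ∀ {σ} B → GroundA B → B ·A σ ≡ B
  ·A-ground (p ⟨ ts ⟩) g =
    cong (p ⟨_⟩) (trans (·Ts-cong ts (λ v v∈ → ⊥-elim (≡[]⇒∉ g v∈))) (·Ts-identity ts))

  ground-·T : ∀ {σ} t → GroundT t → GroundT (t ·T σ)
  ground-·T t g = subst GroundT (sym (·T-ground t g)) g

  ∈-varsT-·T : ∀ {σ v w} t → v ∈ varsT t → w ∈ varsT (σ v) → w ∈ varsT (t ·T σ)
  ∈-varsTs-·Ts : ∀ {σ v w n} (ts : Vec Term n) → v ∈ varsTs ts → w ∈ varsT (σ v) →
                 w ∈ varsTs (ts ·Ts σ)
  ∈-varsT-·T (var x) (here refl) w∈ = w∈
  ∈-varsT-·T (app f ts) v∈ w∈ = ∈-varsTs-·Ts ts v∈ w∈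
  ∈-varsTs-·Ts (t ∷ ts) v∈ w∈ with ∈-++⁻ (varsT t) v∈
  ... | inj₁ v∈t = ∈-++⁺ˡ (∈-varsT-·T t v∈t w∈)
  ... | inj₂ v∈ts = ∈-++⁺ʳ _ (∈-varsTs-·Ts ts v∈ts w∈)

  ground-·T⇒ground : ∀ {σ v} t → GroundT (t ·T σ) → v ∈ varsT t → GroundT (σ v)
  ground-·T⇒ground t g v∈ = ∉⇒≡[] _ (λ w w∈ → ≡[]⇒∉ g (∈-varsT-·T t v∈ w∈))

  ∈-·Ts⁺ : ∀ {σ n u} {ts : Vec Term n} → u VM.∈ ts → (u ·T σ) VM.∈ (ts ·Ts σ)
  ∈-·Ts⁺ {ts = t ∷ ts} (here refl) = here refl
  ∈-·Ts⁺ {ts = t ∷ ts} (there u∈) = there (∈-·Ts⁺ u∈)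

  ∈-·Ts⁻ : ∀ {σ n t} (ts : Vec Term n) → t VM.∈ (ts ·Ts σ) → ∃ λ u → u VM.∈ ts × t ≡ u ·T σ
  ∈-·Ts⁻ (u ∷ ts) (here e) = u , here refl , e
  ∈-·Ts⁻ (u ∷ ts) (there t∈) = let u′ , u′∈ , e = ∈-·Ts⁻ ts t∈ in u′ , there u′∈ , e

  ⟨⟩-injective : ∀ {p q} {as : Vec Term (parity p)} {bs : Vec Term (parity q)} →
                 p ⟨ as ⟩ ≡ q ⟨ bs ⟩ → Σ (p ≡ q) λ { refl → as ≡ bs }
  ⟨⟩-injective refl = refl , refl

  matching-arg : ∀ {σ} (B B′ : Atom) → B ·A σ ≡ B′ ·A σ →
                 ∀ {a} → a VM.∈ args B → ∃ λ b → b VM.∈ args B′ × a ·T σ ≡ b ·T σ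
  matching-arg {σ} (p ⟨ as ⟩) (q ⟨ bs ⟩) e with ⟨⟩-injective e
  ... | refl , e′ = go as bs e′
    where
    go : ∀ {n} (as bs : Vec Term n) → as ·Ts σ ≡ bs ·Ts σ →
         ∀ {a} → a VM.∈ as → ∃ λ b → b VM.∈ bs × a ·T σ ≡ b ·T σ
    go (a ∷ as) (b ∷ bs) e (here refl) = b , here refl , VecP.∷-injectiveˡ e
    go (a ∷ as) (b ∷ bs) e (there a∈) =
      let b′ , b′∈ , e′ = go as bs (VecP.∷-injectiveʳ e) a∈ in b′ , there b′∈ , e′

  -- Corresponding arguments are equated by both σ and σ₀, so θ need only equate the pairs
  -- that both of them equate.
  ·A-unifier : ∀ {σ σ₀ θ : Subst} (B B′ : Atom) → B ·A σ ≡ B′ ·A σ → B ·A σ₀ ≡ B′ ·A σ₀ →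
               (∀ {a b} → a VM.∈ args B → b VM.∈ args B′ →
                  a ·T σ ≡ b ·T σ → a ·T σ₀ ≡ b ·T σ₀ → a ·T θ ≡ b ·T θ) →
               B ·A θ ≡ B′ ·A θ
  ·A-unifier {σ} {σ₀} {θ} (p ⟨ as ⟩) (q ⟨ bs ⟩) e e₀ h with ⟨⟩-injective e | ⟨⟩-injective e₀
  ... | refl , e′ | refl , e₀′ = cong (p ⟨_⟩) (go as bs e′ e₀′ h)
    where
    go : ∀ {n} (as bs : Vec Term n) → as ·Ts σ ≡ bs ·Ts σ → as ·Ts σ₀ ≡ bs ·Ts σ₀ →
         (∀ {a b} → a VM.∈ as → b VM.∈ bs →
            a ·T σ ≡ b ·T σ → a ·T σ₀ ≡ b ·T σ₀ → a ·T θ ≡ b ·T θ) →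
         as ·Ts θ ≡ bs ·Ts θ
    go [] [] _ _ _ = refl
    go (a ∷ as) (b ∷ bs) e e₀ h =
      cong₂ _∷_ (h (here refl) (here refl) (VecP.∷-injectiveˡ e) (VecP.∷-injectiveˡ e₀))
                (go as bs (VecP.∷-injectiveʳ e) (VecP.∷-injectiveʳ e₀)
                    (λ a∈ b∈ → h (there a∈) (there b∈)))

  GroundOrVar : Term → Set
  GroundOrVar t = GroundT t ⊎ IsVar t

  data Shallow : Term → Set where
    flat     : ∀ {t} → GroundOrVar t → Shallow t
    app-flat : ∀ {f ts} → (∀ u → u VM.∈ ts → GroundOrVar u) → Shallow (app f ts)

  ·T-groundOrVar : ∀ {σ : Subst} t → GroundOrVar t →
                   (∀ v → v ∈ varsT t → GroundOrVar (σ v)) → GroundOrVar (t ·T σ)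
  ·T-groundOrVar t (inj₁ g) h = inj₁ (ground-·T t g)
  ·T-groundOrVar t (inj₂ (x , refl)) h = h x (here refl)

  ·T-shallow-of-flat : ∀ {σ : Subst} t → GroundOrVar t → (∀ v → Shallow (σ v)) → Shallow (t ·T σ)
  ·T-shallow-of-flat t (inj₁ g) h = flat (inj₁ (ground-·T t g))
  ·T-shallow-of-flat t (inj₂ (x , refl)) h = h x

  ·T-shallow : ∀ {σ : Subst} t → Shallow t → (∀ v → v ∈ varsT t → GroundOrVar (σ v)) →
               Shallow (t ·T σ)
  ·T-shallow t (flat t-flat) h = flat (·T-groundOrVar t t-flat h)
  ·T-shallow {σ} (app f ts) (app-flat ts-flat) h = app-flat args-flat
    where
    args-flat : ∀ u → u VM.∈ (ts ·Ts σ) → GroundOrVar u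
    args-flat u u∈ with ∈-·Ts⁻ ts u∈
    ... | u′ , u′∈ , refl = ·T-groundOrVar u′ (ts-flat u′ u′∈) (λ v → h v ∘ ∈-varsTs⁺ u′∈)

  var-arg : ∀ {n y} {ts : Vec Term n} → (∀ u → u VM.∈ ts → GroundOrVar u) →
            y ∈ varsTs ts → var y VM.∈ ts
  var-arg {ts = ts} ts-flat y∈ with ∈-varsTs⁻ ts y∈
  ... | u , u∈ , y∈u with ts-flat u u∈
  ...   | inj₁ g = ⊥-elim (≡[]⇒∉ g y∈u)
  ...   | inj₂ (x , refl) with y∈u
  ...     | here refl = u∈

  vdp-ground : ∀ t → GroundT t → vdp t ≡ -1ℤ
  vdp-ground (app f ts) g with varsTs ts
  ... | [] = refl

  -1≤vdp : ∀ t → -1ℤ ℤ.≤ vdp t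
  -1≤vdps : ∀ {n} (ts : Vec Term n) → -1ℤ ℤ.≤ vdps ts
  -1≤vdp (var x) = -≤+
  -1≤vdp (app f ts) with varsTs ts
  ... | [] = ℤP.≤-refl
  ... | _ ∷ _ = ℤP.≤-trans -≤+ (ℤP.+-monoʳ-≤ 1ℤ (-1≤vdps ts))
  -1≤vdps [] = ℤP.≤-refl
  -1≤vdps (t ∷ ts) = ℤP.≤-trans (-1≤vdp t) (ℤP.i≤i⊔j _ _)

  0≤vdp : ∀ t → ¬ GroundT t → 0ℤ ℤ.≤ vdp t
  0≤vdp (var x) _ = +≤+ z≤n
  0≤vdp (app f ts) ng with varsTs ts
  ... | [] = ⊥-elim (ng refl)
  ... | _ ∷ _ = ℤP.+-monoʳ-≤ 1ℤ (-1≤vdps ts)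

  vdp≤-1⇒ground : ∀ t → vdp t ℤ.≤ -1ℤ → GroundT t
  vdp≤-1⇒ground t h with varsT t in e
  ... | [] = refl
  ... | _ ∷ _ with ℤP.≤-trans (0≤vdp t (λ g → ∷≢[] (trans (sym e) g))) h
  ...   | ()

  vdp≤vdps : ∀ {n u} {ts : Vec Term n} → u VM.∈ ts → vdp u ℤ.≤ vdps ts
  vdp≤vdps {ts = t ∷ ts} (here refl) = ℤP.i≤i⊔j (vdp t) (vdps ts)
  vdp≤vdps {ts = t ∷ ts} (there u∈) = ℤP.≤-trans (vdp≤vdps u∈) (ℤP.i≤j⊔i (vdp t) (vdps ts))

  vdps-lub : ∀ {n k} (ts : Vec Term n) → (∀ u → u VM.∈ ts → vdp u ℤ.≤ k) → -1ℤ ℤ.≤ k →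
             vdps ts ℤ.≤ k
  vdps-lub [] h -1≤k = -1≤k
  vdps-lub (t ∷ ts) h -1≤k = ℤP.⊔-lub (h t (here refl)) (vdps-lub ts (λ u → h u ∘ there) -1≤k)

  nonground-arg : ∀ {n x xs} (ts : Vec Term n) → varsTs ts ≡ x ∷ xs →
                  ∃ λ u → u VM.∈ ts × ¬ GroundT u
  nonground-arg {x = x} ts e with ∈-varsTs⁻ ts (subst (x ∈_) (sym e) (here refl))
  ... | u , u∈ , x∈u = u , u∈ , λ g → ≡[]⇒∉ g x∈u

  private
    1+-cancel-≤ : ∀ {i j} → 1ℤ ℤ.+ i ℤ.≤ 1ℤ ℤ.+ j → i ℤ.≤ j
    1+-cancel-≤ {i} {j} h = subst₂ ℤ._≤_ (ℤP.pred-suc i) (ℤP.pred-suc j) (ℤP.pred-mono h)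

  FlatT⇒groundOrVar : ∀ t → FlatT t → GroundOrVar t
  FlatT⇒groundOrVar (var x) _ = inj₂ (x , refl)
  FlatT⇒groundOrVar (app f ts) h with varsTs ts in e
  ... | [] = inj₁ refl
  ... | _ ∷ _ with nonground-arg ts e
  ...   | u , u∈ , ng with ℤP.≤-trans (ℤP.+-monoʳ-≤ 1ℤ (ℤP.≤-trans (0≤vdp u ng) (vdp≤vdps u∈))) h
  ...     | +≤+ ()

  groundOrVar⇒FlatT : ∀ t → GroundOrVar t → FlatT t
  groundOrVar⇒FlatT t (inj₁ g) = subst (ℤ._≤ 0ℤ) (sym (vdp-ground t g)) -≤+
  groundOrVar⇒FlatT t (inj₂ (x , refl)) = ℤP.≤-refl

  SimpleT⇒shallow : ∀ t → SimpleT t → Shallow t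
  SimpleT⇒shallow (var x) _ = flat (inj₂ (x , refl))
  SimpleT⇒shallow (app f ts) h with varsTs ts in e
  ... | [] = flat (inj₁ e)
  ... | _ ∷ _ = app-flat λ u u∈ →
    FlatT⇒groundOrVar u (ℤP.≤-trans (vdp≤vdps u∈) (1+-cancel-≤ {j = 0ℤ} h))

  shallow⇒SimpleT : ∀ t → Shallow t → SimpleT t
  shallow⇒SimpleT t (flat t-flat) = ℤP.≤-trans (groundOrVar⇒FlatT t t-flat) (+≤+ z≤n)
  shallow⇒SimpleT (app f ts) (app-flat ts-flat) with varsTs ts
  ... | [] = -≤+
  ... | _ ∷ _ = ℤP.+-monoʳ-≤ 1ℤ (vdps-lub ts (λ u u∈ → groundOrVar⇒FlatT u (ts-flat u u∈)) -≤+)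

  vdp-arg≤ : ∀ {f u} (ts : Vec Term (arity f)) → u VM.∈ ts → vdp u ℤ.≤ vdp (app f ts)
  vdp-arg≤ {u = u} ts u∈ with varsTs ts in e
  ... | [] = ℤP.≤-reflexive (vdp-ground u (ground-arg e u∈))
  ... | _ ∷ _ = ℤP.≤-trans (vdp≤vdps u∈) (ℤP.i≤suc[i] (vdps ts))

  vdp-arg< : ∀ {f u} (ts : Vec Term (arity f)) → u VM.∈ ts → ¬ GroundT u →
             1ℤ ℤ.+ vdp u ℤ.≤ vdp (app f ts)
  vdp-arg< ts u∈ ng with varsTs ts in e
  ... | [] = ⊥-elim (ng (ground-arg e u∈))
  ... | _ ∷ _ = ℤP.+-monoʳ-≤ 1ℤ (vdp≤vdps u∈)

  vdp-app-mono : ∀ {f g} (us : Vec Term (arity g)) (ts : Vec Term (arity f)) →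
                 (∀ u → u VM.∈ us → GroundT u ⊎ u VM.∈ ts) → vdp (app g us) ℤ.≤ vdp (app f ts)
  vdp-app-mono {f} us ts h with varsTs us in e
  ... | [] = -1≤vdp (app f ts)
  ... | _ ∷ _ with nonground-arg us e
  ...   | u , u∈ , ng with h u u∈
  ...     | inj₁ g = ⊥-elim (ng g)
  ...     | inj₂ u∈ts with varsTs ts in e′
  ...       | [] = ⊥-elim (ng (ground-arg e′ u∈ts))
  ...       | _ ∷ _ = ℤP.+-monoʳ-≤ 1ℤ (vdps-lub us bound (-1≤vdps ts))
    where
    bound : ∀ u′ → u′ VM.∈ us → vdp u′ ℤ.≤ vdps ts
    bound u′ u′∈ with h u′ u′∈
    ... | inj₁ g = ℤP.≤-trans (ℤP.≤-reflexive (vdp-ground u′ g)) (-1≤vdps ts)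
    ... | inj₂ u′∈ts = vdp≤vdps u′∈ts

  vdp-·T≤ : ∀ {σ f s} {bs : Vec Term (arity f)} → Shallow s →
            (∀ y → y ∈ varsT s → var y VM.∈ bs) → vdp (s ·T σ) ℤ.≤ vdp (app f bs ·T σ)
  vdp-·T≤ {σ} {f} {s} {bs} (flat (inj₁ g)) _ =
    subst (ℤ._≤ _) (sym (vdp-ground (s ·T σ) (ground-·T s g))) (-1≤vdp (app f bs ·T σ))
  vdp-·T≤ {σ} {bs = bs} (flat (inj₂ (y , refl))) h =
    vdp-arg≤ (bs ·Ts σ) (∈-·Ts⁺ {ts = bs} (h y (here refl)))
  vdp-·T≤ {σ} {bs = bs} (app-flat {ts = cs} cs-flat) h = vdp-app-mono (cs ·Ts σ) (bs ·Ts σ) bound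
    where
    bound : ∀ u → u VM.∈ (cs ·Ts σ) → GroundT u ⊎ u VM.∈ (bs ·Ts σ)
    bound u u∈ with ∈-·Ts⁻ cs u∈
    ... | c , c∈ , refl with cs-flat c c∈
    ...   | inj₁ g = inj₁ (ground-·T c g)
    ...   | inj₂ (y , refl) = inj₂ (∈-·Ts⁺ {ts = bs} (h y (∈-varsTs⁺ c∈ (here refl))))

  data CoveringArg (V : List ℕ) : Term → Set where
    is-ground : ∀ {t} → GroundT t → CoveringArg V t
    is-var    : ∀ {y} → CoveringArg V (var y)
    covering  : ∀ {f ts} → (∀ u → u VM.∈ ts → GroundOrVar u) →
                (∀ y → y ∈ V → var y VM.∈ ts) → CoveringArg V (app f ts)

  coveringArg : ∀ {V} t → WCTermIn V t → SimpleT t → CoveringArg V t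
  coveringArg (var y) _ _ = is-var
  coveringArg (app f ts) (inj₁ g) _ = is-ground g
  coveringArg (app f ts) (inj₂ (inj₁ (_ , ()))) _
  coveringArg (app f ts) (inj₂ (inj₂ (_ , vars≈))) simple with SimpleT⇒shallow (app f ts) simple
  ... | flat (inj₁ g) = is-ground g
  ... | app-flat ts-flat = covering ts-flat (λ y y∈V → var-arg ts-flat (proj₂ (vars≈ y) y∈V))

  private
    squashBy : List ℕ → Term → Term
    squashBy []      t = t
    squashBy (_ ∷ _) _ = var 0

  squash : Term → Term
  squash t = squashBy (varsT t) t

  private
    squash¹By : List ℕ → Term → Term
    squash¹By []      t          = t
    squash¹By (_ ∷ _) (var _)    = var 0
    squash¹By (_ ∷ _) (app f ts) = app f (Vec.map squash ts)

  squash¹ : Term → Term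
  squash¹ t = squash¹By (varsT t) t

  squash-ground : ∀ {t} → GroundT t → squash t ≡ t
  squash-ground {t} g = cong (λ xs → squashBy xs t) g

  squash¹-ground : ∀ {t} → GroundT t → squash¹ t ≡ t
  squash¹-ground {t} g = cong (λ xs → squash¹By xs t) g

  squash¹-app : ∀ {f} {ts : Vec Term (arity f)} → ¬ GroundT (app f ts) →
                squash¹ (app f ts) ≡ app f (Vec.map squash ts)
  squash¹-app {ts = ts} ng with varsTs ts
  ... | []    = ⊥-elim (ng refl)
  ... | _ ∷ _ = refl

  squash-instance⇒groundOrVar : ∀ {δ : Subst} u → squash u ≡ u ·T δ → GroundOrVar u
  squash-instance⇒groundOrVar (var x) _ = inj₂ (x , refl)
  squash-instance⇒groundOrVar (app f ts) e with varsTs ts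
  ... | []    = inj₁ refl
  ... | _ ∷ _ with e
  ...   | ()

  squash¹-instance⇒shallow : ∀ {δ : Subst} u → squash¹ u ≡ u ·T δ → Shallow u
  squash¹-instance⇒shallow (var x) _ = flat (inj₂ (x , refl))
  squash¹-instance⇒shallow {δ} (app f ts) e with varsTs ts in g
  ... | []    = flat (inj₁ g)
  ... | _ ∷ _ = app-flat (args-flat ts (app-injective e))
    where
    app-injective : ∀ {us vs : Vec Term (arity f)} → app f us ≡ app f vs → us ≡ vs
    app-injective refl = refl
    args-flat : ∀ {n} (us : Vec Term n) → Vec.map squash us ≡ us ·Ts δ →
                ∀ u → u VM.∈ us → GroundOrVar u
    args-flat (u ∷ us) e u (here refl) = squash-instance⇒groundOrVar u (VecP.∷-injectiveˡ e)
    args-flat (_ ∷ us) e u (there u∈) = args-flat us (VecP.∷-injectiveʳ e) u u∈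

  ·L-simple : ∀ {σ} L → (∀ u → u ∈args L → Shallow (u ·T σ)) → SimpleL (L ·L σ)
  ·L-simple (pos B) h t t∈ with ∈-·Ts⁻ (args B) t∈
  ... | u , u∈ , refl = shallow⇒SimpleT _ (h u u∈)
  ·L-simple (neg B) h t t∈ with ∈-·Ts⁻ (args B) t∈
  ... | u , u∈ , refl = shallow⇒SimpleT _ (h u u∈)

module _ (Σ' : Sig) where
  open Syntax Σ'
  open Terms Σ'

  module Res′Resolvent (prec : Precedence) (Sel : Selection) {n : ℕ}
    (A : Fin n → Atom) (D : Clause) (B : Fin n → Atom) (Ds : Fin n → Clause)
    (σ₀ σ : Subst) (premises : Res′Premises prec Sel A D B Ds σ₀)
    (dec : ∀ i → Dec (HasTop A σ₀ i)) (σ-mgu : IsMGU (HasTop A σ₀) A B σ) where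

    open Res′Premises premises
    open QueryPair query

    Top : ℕ → Set
    Top = TopVar A σ₀

    top? : ∀ v → Dec (Top v)
    top? v with v ∈? varsAs A | All.all? (λ y → vdp (σ₀ y) ℤP.≤? vdp (σ₀ v)) (varsAs A)
    ... | yes v∈ | yes maximal = yes (v∈ , λ y y∈ → All.lookup maximal y∈)
    ... | no v∉  | _           = no (v∉ ∘ proj₁)
    ... | yes _  | no ¬maximal = no (λ top → ¬maximal (All.tabulate (proj₂ top _)))

    ∈-varsAs⁺ : ∀ {v} i → v ∈ varsA (A i) → v ∈ varsAs A
    ∈-varsAs⁺ i = ∈-concatMap⁺′ (varsA ∘ A) (∈-allFin i)

    ∈-varsAs⁻ : ∀ {v} → v ∈ varsAs A → ∃ λ i → v ∈ varsA (A i)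
    ∈-varsAs⁻ v∈ = let i , _ , v∈i = ∈-concatMap⁻′ (varsA ∘ A) (allFin n) v∈ in i , v∈i

    ∈-varsAs⇒∈-main : ∀ {v} → v ∈ varsAs A → v ∈ varsC (negs A ++ D)
    ∈-varsAs⇒∈-main v∈ =
      let i , v∈i = ∈-varsAs⁻ v∈ in ∈-concatMap⁺′ varsL (∈-++⁺ˡ (∈-map⁺ (neg ∘ A) (∈-allFin i))) v∈i

    side-var⇒¬top : ∀ {v} i → v ∈ varsA (B i) → ¬ Top v
    side-var⇒¬top {v} i v∈ top = let j , v∈j = ∈-varsAs⁻ (proj₁ top) in AB-disjoint j i v v∈j v∈

    A-arg-flat : ∀ i {a} → a VM.∈ args (A i) → GroundOrVar a
    A-arg-flat i {a} a∈ = FlatT⇒groundOrVar a (A-flat i a a∈)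

    A-var-arg : ∀ i {x} → x ∈ varsA (A i) → var x VM.∈ args (A i)
    A-var-arg i = var-arg (λ _ → A-arg-flat i)

    σ₀-unifies : ∀ i → A i ·A σ₀ ≡ B i ·A σ₀
    σ₀-unifies i = proj₁ σ₀-mgu i tt

    top-ground⇒varsAs-ground : ∀ {z} → Top z → GroundT (σ₀ z) → ∀ w → w ∈ varsAs A → GroundT (σ₀ w)
    top-ground⇒varsAs-ground {z} (_ , maximal) g w w∈ =
      vdp≤-1⇒ground (σ₀ w) (subst (vdp (σ₀ w) ℤ.≤_) (vdp-ground (σ₀ z) g) (maximal w w∈))

    offTopSideVars : List ℕ
    offTopSideVars = concatMap (λ j → if does (dec j) then [] else varsA (B j)) (allFin n)

    ∈-offTopSideVars⁺ : ∀ {v} j → ¬ HasTop A σ₀ j → v ∈ varsA (B j) → v ∈ offTopSideVars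
    ∈-offTopSideVars⁺ {v} j ¬top v∈ = ∈-concatMap⁺′ _ (∈-allFin j) (in-branch (dec j))
      where
      in-branch : (d : Dec (HasTop A σ₀ j)) → v ∈ (if does d then [] else varsA (B j))
      in-branch (yes top) = ⊥-elim (¬top top)
      in-branch (no _)    = v∈

    ∈-offTopSideVars⁻ : ∀ {v} → v ∈ offTopSideVars → ∃ λ j → ¬ HasTop A σ₀ j × v ∈ varsA (B j)
    ∈-offTopSideVars⁻ v∈ =
      let j , _ , v∈j = ∈-concatMap⁻′ _ (allFin n) v∈ in j , from-branch j (dec j) v∈j
      where
      from-branch : ∀ {v} j (d : Dec (HasTop A σ₀ j)) → v ∈ (if does d then [] else varsA (B j)) →
                    ¬ HasTop A σ₀ j × v ∈ varsA (B j)
      from-branch j (no ¬top) v∈ = ¬top , v∈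

    main-var∉offTopSideVars : ∀ {v} → v ∈ varsAs A → v ∉ offTopSideVars
    main-var∉offTopSideVars v∈A v∈ =
      let i , v∈i = ∈-varsAs⁻ v∈A ; j , _ , v∈j = ∈-offTopSideVars⁻ v∈ in AB-disjoint i j _ v∈i v∈j

    top-side-var∉offTopSideVars : ∀ {v} i → HasTop A σ₀ i → v ∈ varsA (B i) → v ∉ offTopSideVars
    top-side-var∉offTopSideVars {v} i top v∈i v∈ with ∈-offTopSideVars⁻ v∈
    ... | j , ¬top , v∈j with j Fin.≟ i
    ...   | yes refl = ¬top top
    ...   | no j≢i   = B-disjoint j i j≢i v v∈j v∈i

    σ/σ₀ : Subst
    σ/σ₀ v with v ∈? offTopSideVars
    ... | yes _ = σ₀ v
    ... | no _  = σ v

    σ/σ₀-off-top : ∀ {v} → v ∈ offTopSideVars → σ/σ₀ v ≡ σ₀ v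
    σ/σ₀-off-top {v} v∈ with v ∈? offTopSideVars
    ... | yes _ = refl
    ... | no v∉ = ⊥-elim (v∉ v∈)

    σ/σ₀-elsewhere : ∀ {v} → v ∉ offTopSideVars → σ/σ₀ v ≡ σ v
    σ/σ₀-elsewhere {v} v∉ with v ∈? offTopSideVars
    ... | yes v∈ = ⊥-elim (v∉ v∈)
    ... | no _   = refl

    σ/σ₀-unifies : (∀ w → w ∈ varsAs A → GroundT (σ₀ w)) → ∀ j → A j ·A σ/σ₀ ≡ B j ·A σ/σ₀
    σ/σ₀-unifies ground j with dec j
    ... | yes top = begin
      A j ·A σ/σ₀ ≡⟨ ·A-cong (A j) (λ _ → σ/σ₀-elsewhere ∘ main-var∉offTopSideVars ∘ ∈-varsAs⁺ j) ⟩
      A j ·A σ    ≡⟨ proj₁ σ-mgu j top ⟩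
      B j ·A σ    ≡⟨ ·A-cong (B j) (λ _ → σ/σ₀-elsewhere ∘ top-side-var∉offTopSideVars j top) ⟨
      B j ·A σ/σ₀ ∎
      where open ≡-Reasoning
    ... | no ¬top = begin
      A j ·A σ/σ₀ ≡⟨ ·A-ground (A j) A-ground ⟩
      A j         ≡⟨ ·A-ground (A j) A-ground ⟨
      A j ·A σ₀   ≡⟨ σ₀-unifies j ⟩
      B j ·A σ₀   ≡⟨ ·A-cong (B j) (λ _ v∈ → σ/σ₀-off-top (∈-offTopSideVars⁺ j ¬top v∈)) ⟨
      B j ·A σ/σ₀ ∎
      where
      open ≡-Reasoning
      all-top : ∀ v → v ∈ varsAs A → Top v
      all-top v v∈ = v∈ , λ y y∈ →
        ℤP.≤-trans (ℤP.≤-reflexive (vdp-ground (σ₀ y) (ground y y∈))) (-1≤vdp (σ₀ v))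
      A-ground : GroundA (A j)
      A-ground = ∉⇒≡[] _ (λ v v∈ → ¬top (v , v∈ , all-top v (∈-varsAs⁺ j v∈)))

    top-σ₀-ground⇒σ-ground : ∀ {z} → Top z → GroundT (σ₀ z) → GroundT (σ z)
    top-σ₀-ground⇒σ-ground {z} top g =
      let δ , σ/σ₀≡σ₀δ = proj₂ σ₀-mgu σ/σ₀ (λ j _ → σ/σ₀-unifies (top-ground⇒varsAs-ground top g) j)
      in subst GroundT (begin
        σ₀ z          ≡⟨ ·T-ground (σ₀ z) g ⟨
        σ₀ z ·T δ     ≡⟨ σ/σ₀≡σ₀δ z ⟨
        σ/σ₀ z        ≡⟨ σ/σ₀-elsewhere (main-var∉offTopSideVars (proj₁ top)) ⟩
        σ z           ∎) g
      where open ≡-Reasoning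

    private
      1+i≰i : ∀ {i} → ¬ (1ℤ ℤ.+ i ℤ.≤ i)
      1+i≰i h = ℤP.<-irrefl refl (ℤP.suc[i]≤j⇒i<j h)

    covering-partner⇒top : ∀ {z f} {bs : Vec Term (arity f)} i → HasTop A σ₀ i →
                           var z VM.∈ args (A i) → (∀ u → u VM.∈ bs → GroundOrVar u) →
                           (∀ y → y ∈ varsA (B i) → var y VM.∈ bs) →
                           σ₀ z ≡ app f bs ·T σ₀ → Top z
    covering-partner⇒top {z} {f} {bs} i (x , x∈ , _ , x-maximal) z∈ bs-flat covers e₀ =
      ∈-varsAs⁺ i (∈-varsTs⁺ z∈ (here refl)) , λ w w∈ → ℤP.≤-trans (x-maximal w w∈) x≤z
      where
      x≤z : vdp (σ₀ x) ℤ.≤ vdp (σ₀ z)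
      x≤z with matching-arg (A i) (B i) (σ₀-unifies i) (A-var-arg i x∈)
      ... | s , s∈ , x≡s = begin
        vdp (σ₀ x)              ≡⟨ cong vdp x≡s ⟩
        vdp (s ·T σ₀)           ≤⟨ vdp-·T≤ (SimpleT⇒shallow s (B-simple i s s∈))
                                           (λ y y∈ → covers y (∈-varsTs⁺ s∈ y∈)) ⟩
        vdp (app f bs ·T σ₀)    ≡⟨ cong vdp e₀ ⟨
        vdp (σ₀ z)              ∎
        where open ℤP.≤-Reasoning

    covered-var⇒σ₀-ground : ∀ {z y f} {ts : Vec Term (arity f)} i → Top z →
                            app f ts VM.∈ args (B i) → var y VM.∈ ts → σ₀ z ≡ σ₀ y → GroundT (σ₀ y)
    covered-var⇒σ₀-ground {z} {y} {f} {ts} i (_ , z-maximal) t∈ y∈ts z≡y with varsT (σ₀ y) in g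
    ... | []    = refl
    ... | _ ∷ _ with matching-arg (B i) (A i) (sym (σ₀-unifies i)) t∈
    ...   | a , a∈ , t≡a with A-arg-flat i a∈
    ...     | inj₁ a-ground = ⊥-elim (∷≢[] (trans (sym g)
                (ground-·T⇒ground (app f ts) (subst GroundT (sym t≡a) (ground-·T a a-ground))
                                              (∈-varsTs⁺ y∈ts (here refl)))))
    ...     | inj₂ (w , refl) = ⊥-elim (1+i≰i (begin
                1ℤ ℤ.+ vdp (σ₀ y)     ≤⟨ vdp-arg< (ts ·Ts σ₀) (∈-·Ts⁺ {ts = ts} y∈ts)
                                                  σ₀y-nonground ⟩
                vdp (app f ts ·T σ₀)  ≡⟨ cong vdp t≡a ⟩
                vdp (σ₀ w)            ≤⟨ z-maximal w (∈-varsAs⁺ i (∈-varsTs⁺ a∈ (here refl))) ⟩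
                vdp (σ₀ z)            ≡⟨ cong vdp z≡y ⟩
                vdp (σ₀ y)            ∎))
      where
      open ℤP.≤-Reasoning
      σ₀y-nonground : ¬ GroundT (σ₀ y)
      σ₀y-nonground = ∷≢[] ∘ trans (sym g)

    var-partner⇒σ-ground : ∀ {z y} i → Top z → var y VM.∈ args (B i) → σ₀ z ≡ σ₀ y → GroundT (σ z)
    var-partner⇒σ-ground {z} {y} i top y∈ z≡y with B-shape i
    ... | inj₂ B-ground = ⊥-elim (≡[]⇒∉ B-ground (∈-varsTs⁺ y∈ (here refl)))
    ... | inj₁ (_ , t , s , t∈ , s⊑t , s-compound , s-nonground)
      with coveringArg t (B-wc i t t∈) (B-simple i t t∈)
    ...   | is-ground g = ⊥-elim (s-nonground (⊑-ground s⊑t g))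
    ...   | is-var = ⊥-elim (⊑-var⇒¬compound s⊑t s-compound)
    ...   | covering _ covers = top-σ₀-ground⇒σ-ground top (subst GroundT (sym z≡y)
      (covered-var⇒σ₀-ground i top t∈ (covers y (∈-varsTs⁺ y∈ (here refl))) z≡y))

    θ : Subst
    θ v with top? v
    ... | yes _ = squash¹ (σ v)
    ... | no _  = squash (σ v)

    θ-top : ∀ {v} → Top v → θ v ≡ squash¹ (σ v)
    θ-top {v} top with top? v
    ... | yes _ = refl
    ... | no ¬top = ⊥-elim (¬top top)

    θ-off-top : ∀ {v} → ¬ Top v → θ v ≡ squash (σ v)
    θ-off-top {v} ¬top with top? v
    ... | yes top = ⊥-elim (¬top top)
    ... | no _    = refl

    θ-ground : ∀ {v} → GroundT (σ v) → θ v ≡ σ v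
    θ-ground {v} g with top? v
    ... | yes _ = squash¹-ground g
    ... | no _  = squash-ground g

    θ-ground-instance : ∀ t → GroundT (t ·T σ) → t ·T θ ≡ t ·T σ
    θ-ground-instance t g = ·T-cong t (λ v v∈ → θ-ground (ground-·T⇒ground t g v∈))

    θ-flat-off-top : ∀ {m} (us : Vec Term m) → (∀ u → u VM.∈ us → GroundOrVar u) →
                     (∀ v → v ∈ varsTs us → ¬ Top v) → Vec.map squash (us ·Ts σ) ≡ us ·Ts θ
    θ-flat-off-top [] _ _ = refl
    θ-flat-off-top (u ∷ us) us-flat ¬top = cong₂ _∷_ (head (us-flat u (here refl)))
      (θ-flat-off-top us (λ u′ → us-flat u′ ∘ there) (λ v → ¬top v ∘ ∈-++⁺ʳ (varsT u)))
      where
      head : GroundOrVar u → squash (u ·T σ) ≡ u ·T θ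
      head (inj₁ g) =
        trans (squash-ground (ground-·T u g)) (sym (θ-ground-instance u (ground-·T u g)))
      head (inj₂ (y , refl)) = sym (θ-off-top (¬top y (here refl)))

    θ-unifies-var-pair : ∀ {z y} i → ¬ GroundT (σ z) → var y VM.∈ args (B i) →
                         σ z ≡ σ y → σ₀ z ≡ σ₀ y → θ z ≡ θ y
    θ-unifies-var-pair {z} {y} i ng y∈ z≡y z≡y₀ = by-cases (top? z)
      where
      open ≡-Reasoning
      by-cases : Dec (Top z) → θ z ≡ θ y
      by-cases (yes top) = ⊥-elim (ng (var-partner⇒σ-ground i top y∈ z≡y₀))
      by-cases (no ¬top) = begin
        θ z          ≡⟨ θ-off-top ¬top ⟩
        squash (σ z) ≡⟨ cong squash z≡y ⟩
        squash (σ y) ≡⟨ θ-off-top (side-var⇒¬top i (∈-varsTs⁺ y∈ (here refl))) ⟨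
        θ y          ∎

    θ-unifies-covering-pair : ∀ {z f} {bs : Vec Term (arity f)} i → HasTop A σ₀ i →
      var z VM.∈ args (A i) → app f bs VM.∈ args (B i) → (∀ u → u VM.∈ bs → GroundOrVar u) →
      (∀ y → y ∈ varsA (B i) → var y VM.∈ bs) → ¬ GroundT (σ z) →
      σ z ≡ app f bs ·T σ → σ₀ z ≡ app f bs ·T σ₀ → θ z ≡ app f bs ·T θ
    θ-unifies-covering-pair {z} {f} {bs} i top-i z∈ b∈ bs-flat covers ng e e₀ = begin
      θ z                             ≡⟨ θ-top (covering-partner⇒top i top-i z∈ bs-flat covers e₀) ⟩
      squash¹ (σ z)                   ≡⟨ cong squash¹ e ⟩
      squash¹ (app f (bs ·Ts σ))      ≡⟨ squash¹-app (ng ∘ subst GroundT (sym e)) ⟩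
      app f (Vec.map squash (bs ·Ts σ)) ≡⟨ cong (app f) (θ-flat-off-top bs bs-flat bs-off-top) ⟩
      app f (bs ·Ts θ)                ∎
      where
      open ≡-Reasoning
      bs-off-top : ∀ v → v ∈ varsTs bs → ¬ Top v
      bs-off-top v v∈ = side-var⇒¬top i (∈-varsTs⁺ b∈ v∈)

    θ-unifies-args : ∀ i → HasTop A σ₀ i → ∀ {a b} → a VM.∈ args (A i) → b VM.∈ args (B i) →
                     a ·T σ ≡ b ·T σ → a ·T σ₀ ≡ b ·T σ₀ → a ·T θ ≡ b ·T θ
    θ-unifies-args i top-i {a} {b} a∈ b∈ e e₀ with varsT (a ·T σ) in g
    ... | [] = begin
      a ·T θ ≡⟨ θ-ground-instance a g ⟩
      a ·T σ ≡⟨ e ⟩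
      b ·T σ ≡⟨ θ-ground-instance b (subst GroundT e g) ⟨
      b ·T θ ∎
      where open ≡-Reasoning
    ... | _ ∷ _ with A-arg-flat i a∈ | coveringArg b (B-wc i b b∈) (B-simple i b b∈)
    ...   | inj₁ a-ground | _ = ⊥-elim (∷≢[] (trans (sym g) (ground-·T a a-ground)))
    ...   | inj₂ (z , refl) | is-ground b-ground =
      ⊥-elim (∷≢[] (trans (sym g) (subst GroundT (sym e) (ground-·T b b-ground))))
    ...   | inj₂ (z , refl) | is-var = θ-unifies-var-pair i (∷≢[] ∘ trans (sym g)) b∈ e e₀
    ...   | inj₂ (z , refl) | covering bs-flat covers =
      θ-unifies-covering-pair i top-i a∈ b∈ bs-flat covers (∷≢[] ∘ trans (sym g)) e e₀

    θ-factors-through-σ : ∃ λ δ → ∀ v → θ v ≡ σ v ·T δ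
    θ-factors-through-σ = proj₂ σ-mgu θ λ i top-i →
      ·A-unifier (A i) (B i) (proj₁ σ-mgu i top-i) (σ₀-unifies i) (θ-unifies-args i top-i)

    σ-off-top-groundOrVar : ∀ v → ¬ Top v → GroundOrVar (σ v)
    σ-off-top-groundOrVar v ¬top = let δ , θ≡σδ = θ-factors-through-σ in
      squash-instance⇒groundOrVar (σ v) (trans (sym (θ-off-top ¬top)) (θ≡σδ v))

    σ-shallow : ∀ v → Shallow (σ v)
    σ-shallow v with top? v
    ... | yes top = let δ , θ≡σδ = θ-factors-through-σ in
      squash¹-instance⇒shallow (σ v) (trans (sym (θ-top top)) (θ≡σδ v))
    ... | no ¬top = flat (σ-off-top-groundOrVar v ¬top)

    D-literal-simple : ∀ {L} → L ∈ D → SimpleL (L ·L σ)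
    D-literal-simple {L} L∈ = ·L-simple L λ u u∈ →
      ·T-shallow-of-flat u (FlatT⇒groundOrVar u (main-flat L (∈-++⁺ʳ (negs A) L∈) u u∈)) σ-shallow

    side-literal-simple : ∀ {L} i → L ∈ Ds i → SimpleL (L ·L σ)
    side-literal-simple {L} i L∈ = ·L-simple L λ u u∈ →
      ·T-shallow u (SimpleT⇒shallow u (proj₁ (side-LGC i) L (there L∈) u u∈))
        (λ v v∈ → σ-off-top-groundOrVar v λ top → side-main-disj i v
          (∈-concatMap⁺′ varsL {xs = sidePremise B Ds i} (there L∈) (∈-varsTs⁺ u∈ v∈))
          (∈-varsAs⇒∈-main (proj₁ top)))

    off-top-guard-simple : ∀ i → ¬ HasTop A σ₀ i → SimpleL (neg (A i) ·L σ)
    off-top-guard-simple i ¬top-i = ·L-simple (neg (A i)) λ u u∈ →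
      flat (·T-groundOrVar u (A-arg-flat i u∈)
        (λ v v∈ → σ-off-top-groundOrVar v λ top → ¬top-i (v , ∈-varsTs⁺ u∈ v∈ , top)))

corollary1 : (Σ' : Sig) → let open Syntax Σ' in
    (prec : Precedence) (Sel : Selection) {n : ℕ}
    (A : Fin n → Atom) (D : Clause) (B : Fin n → Atom) (Ds : Fin n → Clause)
    (σ₀ σ : Subst) →
    Res′Premises prec Sel A D B Ds σ₀ →
    (dec : ∀ i → Dec (HasTop A σ₀ i)) →
    IsMGU (HasTop A σ₀) A B σ →
    SimpleC (resolvent A D Ds dec σ)
corollary1 Σ' prec Sel {n} A D B Ds σ₀ σ premises dec σ-mgu = resolvent-simple
  where
  open Syntax Σ'
  open Res′Resolvent Σ' prec Sel A D B Ds σ₀ σ premises dec σ-mgu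

  selected : ∀ i → Clause
  selected i = if does (dec i) then Ds i else (neg (A i) ∷ [])

  selected-simple : ∀ {L} i (d : Dec (HasTop A σ₀ i)) →
                    L ∈ (if does d then Ds i else (neg (A i) ∷ [])) → SimpleL (L ·L σ)
  selected-simple i (yes _)     L∈          = side-literal-simple i L∈
  selected-simple i (no ¬top-i) (here refl) = off-top-guard-simple i ¬top-i

  premise-literal-simple : ∀ {L} → L ∈ concatMap selected (allFin n) ⊎ L ∈ D → SimpleL (L ·L σ)
  premise-literal-simple (inj₁ L∈) =
    let i , _ , L∈i = ∈-concatMap⁻′ selected (allFin n) L∈ in selected-simple i (dec i) L∈i
  premise-literal-simple (inj₂ L∈) = D-literal-simple L∈

  instance-simple : ∀ {L} → (∃ λ L′ → L′ ∈ concatMap selected (allFin n) ++ D × L ≡ L′ ·L σ) →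
                    SimpleL L
  instance-simple (L′ , L′∈ , refl) =
    premise-literal-simple (∈-++⁻ (concatMap selected (allFin n)) L′∈)

  resolvent-simple : SimpleC (resolvent A D Ds dec σ)
  resolvent-simple L L∈ = instance-simple (∈-map⁻ (_·L σ) L∈)
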